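{- Let $m$ be an even positive integer not divisible by $3$ and let $a,d_1,d_2,d_3\in\mathbb{Z}/m\mathbb{Z}$ be such that $\gcd(d_1,m)=\gcd(d_3-d_2,m)=2$ and $d_2$, $d_3$, $d_2-d_1$, $d_1-d_3$ are invertible. Then the arithmetic tetrahedron $\mathrm{AS}(a,(d_1,d_2,d_3),s)$ is balanced for all positive integers $s\equiv 0$ or $-2\pmod m$.
   Context: $\mathrm{AS}(a,(d_1,d_2,d_3),s)=\{a+i_1d_1+i_2d_2+i_3d_3: i\in\mathbb{N}^3,\ i_1+i_2+i_3\le s-1\}$ as a multiset of $\mathbb{Z}/m\mathbb{Z}$. A multiset is balanced if every element of $\mathbb{Z}/m\mathbb{Z}$ occurs in it with the same multiplicity. For $x\in\mathbb{Z}/m\mathbb{Z}$, $\gcd(x,m)$ is the gcd of $m$ and any representative of $x$. -}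

module Defs where

open import Data.Nat using (ℕ; zero; suc; _+_; _*_; _∸_; _≤_; NonZero)
open import Data.Nat.DivMod using (_%_)
open import Data.Fin using (Fin; toℕ)
open import Data.List using (List; []; _∷_; length; filter; concatMap; upTo)
open import Data.Product using (_×_; _,_; ∃-syntax)
open import Relation.Binary.PropositionalEquality using (_≡_)
open import Relation.Nullary using (yes; no)
open import Data.Nat using (_≟_)

-- Z/mZ is modelled by Fin m; an element x is identified with its
-- canonical representative toℕ x ∈ {0,…,m-1}.

res : (m : ℕ) → .{{NonZero m}} → ℕ → ℕ
res m n = n % m

sub : (m : ℕ) → .{{NonZero m}} → Fin m → Fin m → ℕ
sub m x y = (toℕ x + (m ∸ toℕ y)) % m

Invertible : (m : ℕ) → .{{NonZero m}} → ℕ → Set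
Invertible m x = ∃[ y ] ((x * y) % m ≡ 1 % m)

triples : ℕ → List (ℕ × ℕ × ℕ)
triples s = concatMap (λ i₁ → concatMap (λ i₂ →
              Data.List.map (λ i₃ → (i₁ , i₂ , i₃)) (upTo (s ∸ (i₁ + i₂))))
              (upTo (s ∸ i₁))) (upTo s)

AS : (m : ℕ) → .{{NonZero m}} → Fin m → Fin m → Fin m → Fin m → ℕ → List ℕ
AS m a d₁ d₂ d₃ s =
  Data.List.map (λ { (i₁ , i₂ , i₃) →
     (toℕ a + i₁ * toℕ d₁ + i₂ * toℕ d₂ + i₃ * toℕ d₃) % m }) (triples s)

mult : List ℕ → ℕ → ℕ
mult xs x = length (filter (λ y → y ≟ x) xs)

Balanced : (m : ℕ) → List ℕ → Set
Balanced m xs = ∀ (x y : Fin m) → mult xs (toℕ x) ≡ mult xs (toℕ y)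

module Submission where

-- Let c be the indicator function of a residue class mod m, an m-periodic function ℕ → ℤ.  The
-- multiplicity of that class in AS(a, d, s) is the tetrahedral sum
-- T c a = Σ_{i+j+k<s} c (a + i p + j q + k r) with p, q, r = d₁, d₂, d₃; translating c moves
-- between classes, so balance means that T c is invariant under a ↦ a + 1.  With X, Y, Z the
-- shifts by p, q, r, T = Σ_{l<s} h_l(X, Y, Z) and
-- (Y - X)(X - Z)(Z - Y) h_l = (Y - Z) X^{l+2} + (Z - X) Y^{l+2} + (X - Y) Z^{l+2}.
-- For s ≡ 0 the summed right-hand side kills c (the power sums of the units Y, Z are constant, that
-- of X is 2-invariant, and q, r are odd); for s ≡ -2 the top two layers kill c individually.  A
-- periodic function killed by a difference of unit step is constant, hence has zero differences, so
-- peeling off the factors Y - X and X - Z leaves T c invariant under r - q, hence under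
-- gcd (r - q, m) = 2.  Finally s, p are even and q, r odd, so T annihilates alternating functions;
-- pairing T c with one turns 2-invariance into 1-invariance.

open import Defs
open import Data.Nat as ℕ using (ℕ; zero; suc; _+_; _*_; _∸_; _≤_; _<_; _≟_; NonZero)
open import Data.Nat.Properties as ℕP using ()
open import Data.Nat.DivMod
open import Data.Nat.Divisibility
  using (_∣_; divides; ∣⇒≤; ∣1⇒≡1; ∣m⇒∣m*n; ∣n⇒∣m*n; ∣m+n∣m⇒∣n; %-presˡ-∣; m%n≡0⇒n∣m)
open import Data.Nat.GCD using (gcd; gcd-GCD; gcd[m,n]∣m; module Bézout)
open import Data.Nat.Tactic.RingSolver using (solve) renaming (solve-∀ to ℕ-solve-∀)
open import Algebra.Properties.CommutativeSemigroup ℕP.+-commutativeSemigroup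
  using (xy∙z≈xz∙y; x∙yz≈xz∙y; x∙yz≈y∙xz)
open import Data.Integer as ℤ using (ℤ; 0ℤ)
  renaming (_+_ to _+ᶻ_; _-_ to _-ᶻ_; -_ to -ᶻ_; _*_ to _*ᶻ_)
import Data.Integer.Properties as ℤP
import Data.Integer.Tactic.RingSolver as ℤ-Solver
open import Algebra.Properties.CommutativeSemigroup ℤP.+-commutativeSemigroup
  using () renaming (interchange to +ᶻ-interchange)
open import Algebra.Properties.AbelianGroup ℤP.+-0-abelianGroup
  using (⁻¹-anti-homo‿-; inverseˡ-unique; xyx⁻¹≈y) renaming (∙-cancelˡ to +ᶻ-cancelˡ)
open import Data.Fin using (Fin; toℕ)
open import Data.Fin.Properties using (toℕ≤n; toℕ<n)
open import Data.Bool using (true; false; if_then_else_)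
open import Relation.Nullary.Decidable using (dec-true; dec-false)
open import Relation.Nullary using (yes; no; does; ¬_)
open import Function using (_∘_)
open import Data.List using (List; []; _∷_; _++_; map; concatMap; applyUpTo)
open import Data.Product using (_,_)
open import Data.Sum using (_⊎_; inj₁; inj₂)
open import Data.Empty using (⊥-elim)
open import Relation.Binary.PropositionalEquality

+-minus-interchange : ∀ i j k l → (i +ᶻ j) -ᶻ (k +ᶻ l) ≡ (i -ᶻ k) +ᶻ (j -ᶻ l)
+-minus-interchange i j k l =
  trans (cong (i +ᶻ j +ᶻ_) (ℤP.neg-distrib-+ k l)) (+ᶻ-interchange i j (-ᶻ k) (-ᶻ l))

i-[i-j]≡j : ∀ i j → i -ᶻ (i -ᶻ j) ≡ j
i-[i-j]≡j = ℤ-Solver.solve-∀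

-- Shift invariance and difference operators

Invariant : ℕ → (ℕ → ℤ) → Set
Invariant h f = ∀ b → f (b + h) ≡ f b

shift : (ℕ → ℤ) → ℕ → ℕ → ℤ
shift f h b = f (b + h)

Δ : ℕ → ℕ → (ℕ → ℤ) → ℕ → ℤ
Δ x y f a = f (a + x) -ᶻ f (a + y)

module _ {f : ℕ → ℤ} where

  invariant-* : ∀ {h} → Invariant h f → ∀ k → Invariant (k * h) f
  invariant-* inv zero b = cong f (ℕP.+-identityʳ b)
  invariant-* {h} inv (suc k) b = begin
    f (b + (h + k * h)) ≡⟨ cong f (solve (b ∷ h ∷ k ∷ [])) ⟩
    f (b + k * h + h)   ≡⟨ inv (b + k * h) ⟩
    f (b + k * h)       ≡⟨ invariant-* inv k b ⟩
    f b                 ∎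
    where open ≡-Reasoning

  invariant-∣ : ∀ {d h} → Invariant d f → d ∣ h → Invariant h f
  invariant-∣ inv (divides k refl) = invariant-* inv k

  invariant-2⇒Δ-odd≡0 : Invariant 2 f → ∀ {x y} → 2 ∣ suc x → 2 ∣ suc y → ∀ a → Δ x y f a ≡ 0ℤ
  invariant-2⇒Δ-odd≡0 inv {x} {y} 2∣1+x 2∣1+y a = ℤP.i≡j⇒i-j≡0 (begin
    f (a + x)              ≡⟨ invariant-∣ inv 2∣1+y (a + x) ⟨
    f (a + x + suc y)      ≡⟨ cong f (solve (a ∷ x ∷ y ∷ [])) ⟩
    f (a + y + suc x)      ≡⟨ invariant-∣ inv 2∣1+x (a + y) ⟩
    f (a + y)              ∎)
    where open ≡-Reasoning

  invariant-1⇒constant : Invariant 1 f → ∀ b → f b ≡ f 0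
  invariant-1⇒constant inv zero    = refl
  invariant-1⇒constant inv (suc b) =
    trans (cong f (ℕP.+-comm 1 b)) (trans (inv b) (invariant-1⇒constant inv b))

  invariant-1⇒invariant : Invariant 1 f → ∀ h → Invariant h f
  invariant-1⇒invariant inv h b =
    trans (invariant-1⇒constant inv (b + h)) (sym (invariant-1⇒constant inv b))

module Periodic (m : ℕ) .{{_ : NonZero m}} {f : ℕ → ℤ} (periodic : Invariant m f) where

  periodic-cong : ∀ {b b′} → b % m ≡ b′ % m → f b ≡ f b′
  periodic-cong {b} {b′} eq = begin
    f b                        ≡⟨ cong f (m≡m%n+[m/n]*n b m) ⟩
    f (b % m + (b / m) * m)    ≡⟨ invariant-* periodic (b / m) (b % m) ⟩
    f (b % m)                  ≡⟨ cong f eq ⟩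
    f (b′ % m)                 ≡⟨ invariant-* periodic (b′ / m) (b′ % m) ⟨
    f (b′ % m + (b′ / m) * m)  ≡⟨ cong f (m≡m%n+[m/n]*n b′ m) ⟨
    f b′                       ∎
    where open ≡-Reasoning

  invariant-% : ∀ {h} → Invariant h f → Invariant (h % m) f
  invariant-% {h} inv b = trans (periodic-cong eq) (inv b)
    where
    eq : (b + h % m) % m ≡ (b + h) % m
    eq = trans (%-distribˡ-+ b (h % m) m)
      (trans (cong (λ t → (b % m + t) % m) (m%n%n≡m%n h m)) (sym (%-distribˡ-+ b h m)))

  invariant-unit : ∀ {h} → Invariant h f → Invertible m h → Invariant 1 f
  invariant-unit {h} inv (y , hy≡1) b = trans (periodic-cong eq) (invariant-* inv y b)
    where
    eq : (b + 1) % m ≡ (b + y * h) % m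
    eq = begin
      (b + 1) % m                ≡⟨ %-distribˡ-+ b 1 m ⟩
      (b % m + 1 % m) % m        ≡⟨ cong (λ t → (b % m + t) % m) hy≡1 ⟨
      (b % m + (h * y) % m) % m  ≡⟨ cong (λ t → (b % m + t % m) % m) (ℕP.*-comm h y) ⟩
      (b % m + (y * h) % m) % m  ≡⟨ %-distribˡ-+ b (y * h) m ⟨
      (b + y * h) % m            ∎
      where open ≡-Reasoning

  invariant-gcd : ∀ {h} → Invariant h f → Invariant (gcd h m) f
  invariant-gcd {h} inv b with Bézout.identity (gcd-GCD h m)
  ... | Bézout.+- x y eq = begin
    f (b + gcd h m)             ≡⟨ invariant-* periodic y (b + gcd h m) ⟨
    f (b + gcd h m + y * m)     ≡⟨ cong f (trans (ℕP.+-assoc b _ (y * m)) (cong (b +_) eq)) ⟩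
    f (b + x * h)               ≡⟨ invariant-* inv x b ⟩
    f b                         ∎
    where open ≡-Reasoning
  ... | Bézout.-+ x y eq = begin
    f (b + gcd h m)             ≡⟨ invariant-* inv x (b + gcd h m) ⟨
    f (b + gcd h m + x * h)     ≡⟨ cong f (trans (ℕP.+-assoc b _ (x * h)) (cong (b +_) eq)) ⟩
    f (b + y * m)               ≡⟨ invariant-* periodic y b ⟩
    f b                         ∎
    where open ≡-Reasoning

  -- m κ = f (m x) - f (m y), and both are f 0.
  Δ≡κ⇒κ≡0 : ∀ x y {κ} → (∀ a → Δ x y f a ≡ κ) → κ ≡ 0ℤ
  Δ≡κ⇒κ≡0 x y {κ} Δ≡κ with ℤP.i*j≡0⇒i≡0∨j≡0 (ℤ.+ m) mκ≡0
    where
    iterate : ∀ k b → f (b + k * x) -ᶻ f (b + k * y) ≡ ℤ.+ k *ᶻ κ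
    iterate zero b = ℤP.+-inverseʳ (f (b + 0))
    iterate (suc k) b = begin
      f (b + (x + k * x)) -ᶻ f (b + (y + k * y))
        ≡⟨ cong₂ (λ s t → f s -ᶻ f t) (solve (b ∷ x ∷ k ∷ [])) (solve (b ∷ y ∷ k ∷ [])) ⟩
      f (b + x + k * x) -ᶻ f (b + k * y + y)
        ≡⟨ ℤP.+-minus-telescope (f (b + x + k * x)) (f (b + k * y + x)) (f (b + k * y + y)) ⟨
      (f (b + x + k * x) -ᶻ f (b + k * y + x)) +ᶻ Δ x y f (b + k * y)
        ≡⟨ cong₂ _+ᶻ_ (trans (cong (λ t → f (b + x + k * x) -ᶻ f t) (xy∙z≈xz∙y b (k * y) x)) (iterate k (b + x)))
                      (Δ≡κ _) ⟩
      ℤ.+ k *ᶻ κ +ᶻ κ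
        ≡⟨ trans (ℤP.+-comm _ κ) (sym (ℤP.suc-* (ℤ.+ k) κ)) ⟩
      ℤ.+ suc k *ᶻ κ ∎
      where open ≡-Reasoning
    mκ≡0 : ℤ.+ m *ᶻ κ ≡ 0ℤ
    mκ≡0 = begin
      ℤ.+ m *ᶻ κ                         ≡⟨ iterate m 0 ⟨
      f (m * x) -ᶻ f (m * y)           ≡⟨ cong₂ (λ s t → f s -ᶻ f t) (ℕP.*-comm m x) (ℕP.*-comm m y) ⟩
      f (x * m) -ᶻ f (y * m)           ≡⟨ cong₂ _-ᶻ_ (invariant-* periodic x 0) (invariant-* periodic y 0) ⟩
      f 0 -ᶻ f 0                       ≡⟨ ℤP.+-inverseʳ (f 0) ⟩
      0ℤ                               ∎
      where open ≡-Reasoning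
  ... | inj₂ κ≡0 = κ≡0
  ... | inj₁ m≡0 = ⊥-elim (ℕ.≢-nonZero⁻¹ m (ℤP.+-injective m≡0))

  Δ≡0⇒invariant : (x y : Fin m) → (∀ a → Δ (toℕ x) (toℕ y) f a ≡ 0ℤ) → Invariant (sub m x y) f
  Δ≡0⇒invariant x y Δ≡0 = invariant-% λ b → begin
    f (b + (toℕ x + (m ∸ toℕ y)))      ≡⟨ cong f (x∙yz≈xz∙y b (toℕ x) _) ⟩
    f (b + (m ∸ toℕ y) + toℕ x)        ≡⟨ ℤP.i-j≡0⇒i≡j _ _ (Δ≡0 (b + (m ∸ toℕ y))) ⟩
    f (b + (m ∸ toℕ y) + toℕ y)        ≡⟨ cong f (ℕP.+-assoc b _ (toℕ y)) ⟩
    f (b + ((m ∸ toℕ y) + toℕ y))      ≡⟨ cong (λ t → f (b + t)) (ℕP.m∸n+n≡m (toℕ≤n y)) ⟩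
    f (b + m)                          ≡⟨ periodic b ⟩
    f b                                ∎
    where open ≡-Reasoning

  Δ≡0⇒invariant-1 : (x y : Fin m) → Invertible m (sub m x y) →
                    (∀ a → Δ (toℕ x) (toℕ y) f a ≡ 0ℤ) → Invariant 1 f
  Δ≡0⇒invariant-1 x y unit Δ≡0 = invariant-unit (Δ≡0⇒invariant x y Δ≡0) unit

invariant-1⇒Δ≡0 : ∀ {f} → Invariant 1 f → ∀ x y a → Δ x y f a ≡ 0ℤ
invariant-1⇒Δ≡0 {f} inv x y a =
  trans (cong₂ _-ᶻ_ (invariant-1⇒constant inv (a + x)) (invariant-1⇒constant inv (a + y))) (ℤP.+-inverseʳ (f 0))

Δ-invariant : ∀ {h f} x y → Invariant h f → Invariant h (Δ x y f)
Δ-invariant {h} {f} x y inv b = cong₂ _-ᶻ_ (shifted x) (shifted y)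
  where
  shifted : ∀ z → f (b + h + z) ≡ f (b + z)
  shifted z = trans (cong f (xy∙z≈xz∙y b h z)) (inv (b + z))

Δ-Δ≡0⇒Δ≡0 : ∀ m .{{_ : NonZero m}} {f} → Invariant m f → (u v : Fin m) → ∀ x y →
            Invertible m (sub m u v) → (∀ a → Δ (toℕ u) (toℕ v) (Δ x y f) a ≡ 0ℤ) →
            ∀ a → Δ x y f a ≡ 0ℤ
Δ-Δ≡0⇒Δ≡0 m {f} periodic u v x y unit ΔΔ≡0 a =
  trans (invariant-1⇒constant constant a) (Δ≡κ⇒κ≡0 x y (invariant-1⇒constant constant))
  where
  open Periodic m periodic using (Δ≡κ⇒κ≡0)
  constant : Invariant 1 (Δ x y f)
  constant = Periodic.Δ≡0⇒invariant-1 m (Δ-invariant x y periodic) u v unit ΔΔ≡0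

-- Alternating functions

Alternating : (ℕ → ℤ) → Set
Alternating g = ∀ b → g (b + 1) ≡ -ᶻ g b

module _ {g : ℕ → ℤ} (alt : Alternating g) where

  alternating⇒invariant-2 : Invariant 2 g
  alternating⇒invariant-2 b = begin
    g (b + 2)       ≡⟨ cong g (ℕP.+-assoc b 1 1) ⟨
    g (b + 1 + 1)   ≡⟨ alt (b + 1) ⟩
    -ᶻ g (b + 1)    ≡⟨ cong -ᶻ_ (alt b) ⟩
    -ᶻ -ᶻ g b       ≡⟨ ℤP.neg-involutive (g b) ⟩
    g b             ∎
    where open ≡-Reasoning

  alternating-odd : ∀ {q} → 2 ∣ suc q → ∀ b → g (b + q) ≡ -ᶻ g b
  alternating-odd {q} 2∣1+q b = begin
    g (b + q)             ≡⟨ ℤP.neg-involutive (g (b + q)) ⟨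
    -ᶻ -ᶻ g (b + q)       ≡⟨ cong -ᶻ_ (alt (b + q)) ⟨
    -ᶻ g (b + q + 1)      ≡⟨ cong (λ t → -ᶻ g t) (trans (ℕP.+-assoc b q 1) (cong (b +_) (ℕP.+-comm q 1))) ⟩
    -ᶻ g (b + suc q)      ≡⟨ cong -ᶻ_ (invariant-∣ alternating⇒invariant-2 2∣1+q b) ⟩
    -ᶻ g b                ∎
    where open ≡-Reasoning

alternation : ℕ → (ℕ → ℤ) → ℕ → ℤ
alternation zero    g a = 0ℤ
alternation (suc j) g a = (g a -ᶻ g (a + 1)) +ᶻ alternation j g (a + 2)

alternation-telescope : ∀ j g a → alternation j g (a + 1) +ᶻ alternation j g a ≡ g a -ᶻ g (a + j * 2)
alternation-telescope zero g a =
  trans (sym (ℤP.+-inverseʳ (g a))) (cong (λ t → g a -ᶻ g t) (sym (ℕP.+-identityʳ a)))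
alternation-telescope (suc j) g a = begin
  ((g (a + 1) -ᶻ g (a + 1 + 1)) +ᶻ alternation j g (a + 1 + 2)) +ᶻ ((g a -ᶻ g (a + 1)) +ᶻ alternation j g (a + 2))
    ≡⟨ cong₂ (λ s t → ((g (a + 1) -ᶻ g s) +ᶻ alternation j g t) +ᶻ ((g a -ᶻ g (a + 1)) +ᶻ alternation j g (a + 2)))
             (ℕP.+-assoc a 1 1) (xy∙z≈xz∙y a 1 2) ⟩
  ((g (a + 1) -ᶻ g (a + 2)) +ᶻ alternation j g (a + 2 + 1)) +ᶻ ((g a -ᶻ g (a + 1)) +ᶻ alternation j g (a + 2))
    ≡⟨ regroup (g a) (g (a + 1)) (g (a + 2)) (alternation j g (a + 2 + 1)) (alternation j g (a + 2)) ⟩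
  (g a -ᶻ g (a + 2)) +ᶻ (alternation j g (a + 2 + 1) +ᶻ alternation j g (a + 2))
    ≡⟨ cong ((g a -ᶻ g (a + 2)) +ᶻ_) (alternation-telescope j g (a + 2)) ⟩
  (g a -ᶻ g (a + 2)) +ᶻ (g (a + 2) -ᶻ g (a + 2 + j * 2))
    ≡⟨ ℤP.+-minus-telescope (g a) (g (a + 2)) (g (a + 2 + j * 2)) ⟩
  g a -ᶻ g (a + 2 + j * 2)
    ≡⟨ cong (λ t → g a -ᶻ g t) (ℕP.+-assoc a 2 (j * 2)) ⟩
  g a -ᶻ g (a + suc j * 2) ∎
  where
  open ≡-Reasoning
  regroup : ∀ x₀ x₁ x₂ y z → ((x₁ -ᶻ x₂) +ᶻ y) +ᶻ ((x₀ -ᶻ x₁) +ᶻ z) ≡ (x₀ -ᶻ x₂) +ᶻ (y +ᶻ z)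
  regroup = ℤ-Solver.solve-∀

alternation-alternating : ∀ j {g} → Invariant (j * 2) g → Alternating (alternation j g)
alternation-alternating j {g} inv a = inverseˡ-unique _ _ (begin
  alternation j g (a + 1) +ᶻ alternation j g a  ≡⟨ alternation-telescope j g a ⟩
  g a -ᶻ g (a + j * 2)                          ≡⟨ cong (λ t → g a -ᶻ t) (inv a) ⟩
  g a -ᶻ g a                                    ≡⟨ ℤP.+-inverseʳ (g a) ⟩
  0ℤ                                            ∎)
  where open ≡-Reasoning

alternation-invariant-2 : ∀ j {g} → Invariant 2 g → ∀ a → alternation j g a ≡ ℤ.+ j *ᶻ (g a -ᶻ g (a + 1))
alternation-invariant-2 zero    inv a = refl
alternation-invariant-2 (suc j) {g} inv a = begin
  (g a -ᶻ g (a + 1)) +ᶻ alternation j g (a + 2)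
    ≡⟨ cong ((g a -ᶻ g (a + 1)) +ᶻ_) (alternation-invariant-2 j inv (a + 2)) ⟩
  (g a -ᶻ g (a + 1)) +ᶻ ℤ.+ j *ᶻ (g (a + 2) -ᶻ g (a + 2 + 1))
    ≡⟨ cong (λ t → (g a -ᶻ g (a + 1)) +ᶻ ℤ.+ j *ᶻ t)
            (cong₂ _-ᶻ_ (inv a) (trans (cong g (xy∙z≈xz∙y a 2 1)) (inv (a + 1)))) ⟩
  (g a -ᶻ g (a + 1)) +ᶻ ℤ.+ j *ᶻ (g a -ᶻ g (a + 1))     ≡⟨ ℤP.suc-* (ℤ.+ j) _ ⟨
  ℤ.+ suc j *ᶻ (g a -ᶻ g (a + 1))                       ∎
  where open ≡-Reasoning

-- Shift-linear operators

record ShiftLinear (Φ : (ℕ → ℤ) → ℕ → ℤ) : Set where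
  field
    pointwise-cong : ∀ {f g} → (∀ b → f b ≡ g b) → ∀ a → Φ f a ≡ Φ g a
    +-homo         : ∀ f g a → Φ (λ b → f b +ᶻ g b) a ≡ Φ f a +ᶻ Φ g a
    -‿homo         : ∀ f a → Φ (λ b → -ᶻ f b) a ≡ -ᶻ Φ f a
    shift-comm     : ∀ f h a → Φ (λ b → f (b + h)) a ≡ Φ f (a + h)

  −-homo : ∀ f g a → Φ (λ b → f b -ᶻ g b) a ≡ Φ f a -ᶻ Φ g a
  −-homo f g a = trans (+-homo f (λ b → -ᶻ g b) a) (cong (Φ f a +ᶻ_) (-‿homo g a))

  0-homo : ∀ a → Φ (λ _ → 0ℤ) a ≡ 0ℤ
  0-homo a = +ᶻ-cancelˡ z z 0ℤ (trans (sym (+-homo (λ _ → 0ℤ) (λ _ → 0ℤ) a)) (sym (ℤP.+-identityʳ z)))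
    where z = Φ (λ _ → 0ℤ) a

  invariant : ∀ {h f} → Invariant h f → Invariant h (Φ f)
  invariant {h} {f} inv b = trans (sym (shift-comm f h b)) (pointwise-cong inv b)

  alternating : ∀ {g} → Alternating g → Alternating (Φ g)
  alternating {g} alt b = trans (sym (shift-comm g 1 b)) (trans (pointwise-cong alt b) (-‿homo g b))

  alternation-comm : ∀ j c a → Φ (alternation j c) a ≡ alternation j (Φ c) a
  alternation-comm zero    c a = 0-homo a
  alternation-comm (suc j) c a = begin
    Φ (λ b → (c b -ᶻ c (b + 1)) +ᶻ alternation j c (b + 2)) a
      ≡⟨ +-homo (λ b → c b -ᶻ c (b + 1)) (λ b → alternation j c (b + 2)) a ⟩
    Φ (λ b → c b -ᶻ c (b + 1)) a +ᶻ Φ (λ b → alternation j c (b + 2)) a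
      ≡⟨ cong₂ _+ᶻ_ (trans (−-homo c (λ b → c (b + 1)) a) (cong (λ t → Φ c a -ᶻ t) (shift-comm c 1 a)))
                    (shift-comm (alternation j c) 2 a) ⟩
    (Φ c a -ᶻ Φ c (a + 1)) +ᶻ Φ (alternation j c) (a + 2)
      ≡⟨ cong ((Φ c a -ᶻ Φ c (a + 1)) +ᶻ_) (alternation-comm j c (a + 2)) ⟩
    alternation (suc j) (Φ c) a ∎
    where open ≡-Reasoning

  Δ-comm : ∀ x y f a → Δ x y (Φ f) a ≡ Φ (Δ x y f) a
  Δ-comm x y f a = sym (trans (−-homo _ _ a) (cong₂ _-ᶻ_ (shift-comm f x a) (shift-comm f y a)))

open ShiftLinear

Δ-shiftLinear : ∀ x y → ShiftLinear (Δ x y)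
Δ-shiftLinear x y .pointwise-cong f≗g a = cong₂ _-ᶻ_ (f≗g (a + x)) (f≗g (a + y))
Δ-shiftLinear x y .+-homo f g a = +-minus-interchange (f (a + x)) (g (a + x)) (f (a + y)) (g (a + y))
Δ-shiftLinear x y .-‿homo f a = sym (ℤP.neg-distrib-+ (f (a + x)) (-ᶻ f (a + y)))
Δ-shiftLinear x y .shift-comm f h a = cong₂ _-ᶻ_ (cong f (xy∙z≈xz∙y a x h)) (cong f (xy∙z≈xz∙y a y h))

∘-shiftLinear : ∀ {Φ Ψ} → ShiftLinear Φ → ShiftLinear Ψ → ShiftLinear (λ f → Φ (Ψ f))
∘-shiftLinear lin₁ lin₂ .pointwise-cong f≗g = lin₁ .pointwise-cong (lin₂ .pointwise-cong f≗g)
∘-shiftLinear lin₁ lin₂ .+-homo f g a = trans (lin₁ .pointwise-cong (lin₂ .+-homo f g) a) (lin₁ .+-homo _ _ a)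
∘-shiftLinear lin₁ lin₂ .-‿homo f a = trans (lin₁ .pointwise-cong (lin₂ .-‿homo f) a) (lin₁ .-‿homo _ a)
∘-shiftLinear lin₁ lin₂ .shift-comm f h a =
  trans (lin₁ .pointwise-cong (lin₂ .shift-comm f h) a) (lin₁ .shift-comm _ h a)

stack : ℕ → (ℕ → ℕ → ℤ) → ℕ → ℕ → ℤ
stack h F zero    a = 0ℤ
stack h F (suc n) a = F (suc n) a +ᶻ stack h F n (a + h)

stack-shiftLinear : ∀ h {G : ℕ → (ℕ → ℤ) → ℕ → ℤ} → (∀ k → ShiftLinear (G k)) →
                    ∀ n → ShiftLinear (λ c → stack h (λ k → G k c) n)
stack-shiftLinear h lin zero .pointwise-cong f≗g a = refl
stack-shiftLinear h lin zero .+-homo f g a = refl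
stack-shiftLinear h lin zero .-‿homo f a = refl
stack-shiftLinear h lin zero .shift-comm f k a = refl
stack-shiftLinear h lin (suc n) .pointwise-cong f≗g a =
  cong₂ _+ᶻ_ (lin (suc n) .pointwise-cong f≗g a) (stack-shiftLinear h lin n .pointwise-cong f≗g (a + h))
stack-shiftLinear h {G} lin (suc n) .+-homo f g a =
  trans (cong₂ _+ᶻ_ (lin (suc n) .+-homo f g a) (stack-shiftLinear h lin n .+-homo f g (a + h)))
        (+ᶻ-interchange (G (suc n) f a) _ _ _)
stack-shiftLinear h {G} lin (suc n) .-‿homo f a =
  trans (cong₂ _+ᶻ_ (lin (suc n) .-‿homo f a) (stack-shiftLinear h lin n .-‿homo f (a + h)))
        (sym (ℤP.neg-distrib-+ (G (suc n) f a) _))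
stack-shiftLinear h {G} lin (suc n) .shift-comm f k a =
  cong₂ _+ᶻ_ (lin (suc n) .shift-comm f k a)
    (trans (stack-shiftLinear h lin n .shift-comm f k (a + h))
           (cong (stack h (λ j → G j f) n) (xy∙z≈xz∙y a h k)))

-- Tetrahedral sums

powerSum : (ℕ → ℤ) → ℕ → ℕ → ℕ → ℤ
powerSum c x zero    b = 0ℤ
powerSum c x (suc n) b = powerSum c x n b +ᶻ shift c (suc (suc n) * x) b

powerSum-invariant : ∀ {h c} → Invariant h c → ∀ x n → Invariant h (powerSum c x n)
powerSum-invariant inv x zero    b = refl
powerSum-invariant {h} {c} inv x (suc n) b =
  cong₂ _+ᶻ_ (powerSum-invariant inv x n b) (trans (cong c (xy∙z≈xz∙y b h _)) (inv _))

powerSum-telescope : ∀ c x n b → powerSum c x n (b + x) -ᶻ powerSum c x n b ≡ c (b + suc (suc n) * x) -ᶻ c (b + 2 * x)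
powerSum-telescope c x zero    b = sym (ℤP.+-inverseʳ (c (b + 2 * x)))
powerSum-telescope c x (suc n) b = begin
  (S (b + x) +ᶻ c (b + x + N * x)) -ᶻ (S b +ᶻ c (b + N * x))
    ≡⟨ +-minus-interchange (S (b + x)) (c (b + x + N * x)) (S b) (c (b + N * x)) ⟩
  (S (b + x) -ᶻ S b) +ᶻ (c (b + x + N * x) -ᶻ c (b + N * x))
    ≡⟨ cong (_+ᶻ (c (b + x + N * x) -ᶻ c (b + N * x))) (powerSum-telescope c x n b) ⟩
  (c (b + N * x) -ᶻ c (b + 2 * x)) +ᶻ (c (b + x + N * x) -ᶻ c (b + N * x))
    ≡⟨ ℤP.+-comm (c (b + N * x) -ᶻ c (b + 2 * x)) _ ⟩
  (c (b + x + N * x) -ᶻ c (b + N * x)) +ᶻ (c (b + N * x) -ᶻ c (b + 2 * x))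
    ≡⟨ ℤP.+-minus-telescope (c (b + x + N * x)) (c (b + N * x)) (c (b + 2 * x)) ⟩
  c (b + x + N * x) -ᶻ c (b + 2 * x)
    ≡⟨ cong (λ t → c t -ᶻ c (b + 2 * x)) (ℕP.+-assoc b x (N * x)) ⟩
  c (b + suc N * x) -ᶻ c (b + 2 * x) ∎
  where
  open ≡-Reasoning
  S = powerSum c x n
  N = suc (suc n)

powerSum-multiple-invariant : ∀ m {c} → Invariant m c → ∀ x t → Invariant x (powerSum c x (t * m))
powerSum-multiple-invariant m {c} periodic x t b = ℤP.i-j≡0⇒i≡j _ _ (begin
  powerSum c x (t * m) (b + x) -ᶻ powerSum c x (t * m) b
    ≡⟨ powerSum-telescope c x (t * m) b ⟩
  c (b + suc (suc (t * m)) * x) -ᶻ c (b + 2 * x)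
    ≡⟨ cong (λ s → c s -ᶻ c (b + 2 * x)) (solve (b ∷ t ∷ m ∷ x ∷ [])) ⟩
  c (b + 2 * x + (t * x) * m) -ᶻ c (b + 2 * x)
    ≡⟨ cong (_-ᶻ c (b + 2 * x)) (invariant-* periodic (t * x) (b + 2 * x)) ⟩
  c (b + 2 * x) -ᶻ c (b + 2 * x)
    ≡⟨ ℤP.+-inverseʳ (c (b + 2 * x)) ⟩
  0ℤ ∎)
  where open ≡-Reasoning

Σ< : ℕ → (ℕ → ℤ) → ℤ
Σ< zero    f = 0ℤ
Σ< (suc n) f = f 0 +ᶻ Σ< n (f ∘ suc)

Σ<-cong : ∀ n {f g} → (∀ i → f i ≡ g i) → Σ< n f ≡ Σ< n g
Σ<-cong zero    f≗g = refl
Σ<-cong (suc n) f≗g = cong₂ _+ᶻ_ (f≗g 0) (Σ<-cong n (f≗g ∘ suc))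

module Simplex (p q r : ℕ) where

  -- tetrahedron c n a = Σ_{i + j + k < n} c (a + i p + j q + k r), and similarly in dimensions 1, 2.
  line triangle tetrahedron : (ℕ → ℤ) → ℕ → ℕ → ℤ
  line c        = stack r (λ _ → c)
  triangle c    = stack q (line c)
  tetrahedron c = stack p (triangle c)

  line-shiftLinear : ∀ n → ShiftLinear (λ c → line c n)
  line-shiftLinear = stack-shiftLinear r (λ _ → id-shiftLinear)
    where
    id-shiftLinear : ShiftLinear (λ c → c)
    id-shiftLinear .pointwise-cong f≗g = f≗g
    id-shiftLinear .+-homo f g a = refl
    id-shiftLinear .-‿homo f a = refl
    id-shiftLinear .shift-comm f h a = refl

  triangle-shiftLinear : ∀ n → ShiftLinear (λ c → triangle c n)
  triangle-shiftLinear = stack-shiftLinear q line-shiftLinear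

  tetrahedron-shiftLinear : ∀ n → ShiftLinear (λ c → tetrahedron c n)
  tetrahedron-shiftLinear = stack-shiftLinear p triangle-shiftLinear

  -- The complete homogeneous sums  h₂ x y c n a = Σ_{i + k = n} c (a + i x + k y)  and
  -- h₃ c n a = Σ_{i + j + k = n} c (a + i p + j q + k r): the layers of the tetrahedron.
  h₂ : ℕ → ℕ → (ℕ → ℤ) → ℕ → ℕ → ℤ
  h₂ x y c zero    a = c a
  h₂ x y c (suc n) a = c (a + suc n * y) +ᶻ h₂ x y c n (a + x)

  h₃ : (ℕ → ℤ) → ℕ → ℕ → ℤ
  h₃ c zero    a = c a
  h₃ c (suc n) a = h₂ q r c (suc n) a +ᶻ h₃ c n (a + p)

  line-suc : ∀ c n a → line c (suc n) a ≡ line c n a +ᶻ c (a + n * r)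
  line-suc c zero a = trans (ℤP.+-comm (c a) 0ℤ) (cong (λ t → 0ℤ +ᶻ c t) (sym (ℕP.+-identityʳ a)))
  line-suc c (suc n) a = begin
    c a +ᶻ line c (suc n) (a + r)                  ≡⟨ cong (c a +ᶻ_) (line-suc c n (a + r)) ⟩
    c a +ᶻ (line c n (a + r) +ᶻ c (a + r + n * r))  ≡⟨ ℤP.+-assoc (c a) _ _ ⟨
    line c (suc n) a +ᶻ c (a + r + n * r)           ≡⟨ cong (λ t → line c (suc n) a +ᶻ c t) (ℕP.+-assoc a r (n * r)) ⟩
    line c (suc n) a +ᶻ c (a + suc n * r)           ∎
    where open ≡-Reasoning

  triangle-suc : ∀ c n a → triangle c (suc n) a ≡ triangle c n a +ᶻ h₂ q r c n a
  triangle-suc c zero a = trans (ℤP.+-identityʳ _) (trans (ℤP.+-identityʳ (c a)) (sym (ℤP.+-identityˡ _)))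
  triangle-suc c (suc n) a =
    trans (cong₂ _+ᶻ_ (line-suc c (suc n) a) (triangle-suc c n (a + q)))
          (+ᶻ-interchange (line c (suc n) a) _ _ _)

  tetrahedron-suc : ∀ c n a → tetrahedron c (suc n) a ≡ tetrahedron c n a +ᶻ h₃ c n a
  tetrahedron-suc c zero a =
    trans (ℤP.+-identityʳ _) (trans (ℤP.+-identityʳ _) (trans (ℤP.+-identityʳ (c a)) (sym (ℤP.+-identityˡ _))))
  tetrahedron-suc c (suc n) a =
    trans (cong₂ _+ᶻ_ (triangle-suc c (suc n) a) (tetrahedron-suc c n (a + p)))
          (+ᶻ-interchange (triangle c (suc n) a) _ _ _)

  tetrahedron-suc-suc : ∀ c n a → tetrahedron c (2 + n) a ≡ tetrahedron c n a +ᶻ (h₃ c n a +ᶻ h₃ c (suc n) a)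
  tetrahedron-suc-suc c n a =
    trans (tetrahedron-suc c (suc n) a)
          (trans (cong (_+ᶻ h₃ c (suc n) a) (tetrahedron-suc c n a)) (ℤP.+-assoc (tetrahedron c n a) _ _))

  line-Σ : ∀ c n b → Σ< n (λ k → c (b + k * r)) ≡ line c n b
  line-Σ c zero    b = refl
  line-Σ c (suc n) b = cong₂ _+ᶻ_ (cong c (ℕP.+-identityʳ b))
    (trans (Σ<-cong n (λ k → cong c (sym (ℕP.+-assoc b r (k * r))))) (line-Σ c n (b + r)))

  triangle-Σ : ∀ c n b → Σ< n (λ j → Σ< (n ∸ j) (λ k → c (b + j * q + k * r))) ≡ triangle c n b
  triangle-Σ c zero    b = refl
  triangle-Σ c (suc n) b = cong₂ _+ᶻ_
    (trans (Σ<-cong (suc n) (λ k → cong (λ t → c (t + k * r)) (ℕP.+-identityʳ b))) (line-Σ c (suc n) b))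
    (trans (Σ<-cong n (λ j → Σ<-cong (n ∸ j) (λ k → cong (λ t → c (t + k * r)) (sym (ℕP.+-assoc b q (j * q))))))
           (triangle-Σ c n (b + q)))

  tetrahedron-Σ : ∀ c n b →
    Σ< n (λ i → Σ< (n ∸ i) (λ j → Σ< (n ∸ (i + j)) (λ k → c (b + i * p + j * q + k * r)))) ≡ tetrahedron c n b
  tetrahedron-Σ c zero    b = refl
  tetrahedron-Σ c (suc n) b = cong₂ _+ᶻ_
    (trans (Σ<-cong (suc n) (λ j → Σ<-cong (suc n ∸ j) (λ k → cong (λ t → c (t + j * q + k * r)) (ℕP.+-identityʳ b))))
           (triangle-Σ c (suc n) b))
    (trans (Σ<-cong n (λ i → Σ<-cong (n ∸ i) (λ j → Σ<-cong (n ∸ (i + j)) (λ k →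
              cong (λ t → c (t + j * q + k * r)) (sym (ℕP.+-assoc b p (i * p)))))))
           (tetrahedron-Σ c n (b + p)))

  h₂-telescope : ∀ x y c n a → Δ x y (h₂ x y c n) a ≡ c (a + suc n * x) -ᶻ c (a + suc n * y)
  h₂-telescope x y c zero a =
    cong₂ (λ s t → c s -ᶻ c t) (cong (a +_) (sym (ℕP.+-identityʳ x))) (cong (a +_) (sym (ℕP.+-identityʳ y)))
  h₂-telescope x y c (suc n) a = begin
    (c (a + x + ny) +ᶻ H (a + x + x)) -ᶻ (c (a + y + ny) +ᶻ H (a + y + x))
      ≡⟨ +-minus-interchange (c (a + x + ny)) (H (a + x + x)) (c (a + y + ny)) (H (a + y + x)) ⟩
    (c (a + x + ny) -ᶻ c (a + y + ny)) +ᶻ (H (a + x + x) -ᶻ H (a + y + x))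
      ≡⟨ cong (λ t → (c (a + x + ny) -ᶻ c (a + y + ny)) +ᶻ (H (a + x + x) -ᶻ H t)) (xy∙z≈xz∙y a y x) ⟩
    (c (a + x + ny) -ᶻ c (a + y + ny)) +ᶻ Δ x y H (a + x)
      ≡⟨ cong ((c (a + x + ny) -ᶻ c (a + y + ny)) +ᶻ_) (h₂-telescope x y c n (a + x)) ⟩
    (c (a + x + ny) -ᶻ c (a + y + ny)) +ᶻ (c (a + x + nx) -ᶻ c (a + x + ny))
      ≡⟨ ℤP.+-comm (c (a + x + ny) -ᶻ c (a + y + ny)) _ ⟩
    (c (a + x + nx) -ᶻ c (a + x + ny)) +ᶻ (c (a + x + ny) -ᶻ c (a + y + ny))
      ≡⟨ ℤP.+-minus-telescope (c (a + x + nx)) (c (a + x + ny)) (c (a + y + ny)) ⟩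
    c (a + x + nx) -ᶻ c (a + y + ny)
      ≡⟨ cong₂ (λ s t → c s -ᶻ c t) (ℕP.+-assoc a x nx) (ℕP.+-assoc a y ny) ⟩
    c (a + suc (suc n) * x) -ᶻ c (a + suc (suc n) * y) ∎
    where
    open ≡-Reasoning
    H = h₂ x y c n
    nx = suc n * x
    ny = suc n * y

  h₃-telescope : ∀ c n a → Δ r q (h₃ c n) a ≡ h₂ p r c (suc n) a -ᶻ h₂ p q c (suc n) a
  h₃-telescope c zero a = sym (begin
    (c (a + (r + 0)) +ᶻ c (a + p)) -ᶻ (c (a + (q + 0)) +ᶻ c (a + p))
      ≡⟨ +-minus-interchange (c (a + (r + 0))) (c (a + p)) (c (a + (q + 0))) (c (a + p)) ⟩
    (c (a + (r + 0)) -ᶻ c (a + (q + 0))) +ᶻ (c (a + p) -ᶻ c (a + p))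
      ≡⟨ cong ((c (a + (r + 0)) -ᶻ c (a + (q + 0))) +ᶻ_) (ℤP.+-inverseʳ (c (a + p))) ⟩
    (c (a + (r + 0)) -ᶻ c (a + (q + 0))) +ᶻ 0ℤ
      ≡⟨ ℤP.+-identityʳ _ ⟩
    c (a + (r + 0)) -ᶻ c (a + (q + 0))
      ≡⟨ cong₂ (λ s t → c (a + s) -ᶻ c (a + t)) (ℕP.+-identityʳ r) (ℕP.+-identityʳ q) ⟩
    c (a + r) -ᶻ c (a + q) ∎)
    where open ≡-Reasoning
  h₃-telescope c (suc n) a = begin
    (G (a + r) +ᶻ h₃ c n (a + r + p)) -ᶻ (G (a + q) +ᶻ h₃ c n (a + q + p))
      ≡⟨ +-minus-interchange (G (a + r)) (h₃ c n (a + r + p)) (G (a + q)) (h₃ c n (a + q + p)) ⟩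
    (G (a + r) -ᶻ G (a + q)) +ᶻ (h₃ c n (a + r + p) -ᶻ h₃ c n (a + q + p))
      ≡⟨ cong₂ _+ᶻ_ (sym (⁻¹-anti-homo‿- (G (a + q)) (G (a + r))))
                    (cong₂ (λ s t → h₃ c n s -ᶻ h₃ c n t) (xy∙z≈xz∙y a r p) (xy∙z≈xz∙y a q p)) ⟩
    -ᶻ Δ q r G a +ᶻ Δ r q (h₃ c n) (a + p)
      ≡⟨ cong₂ (λ s t → -ᶻ s +ᶻ t) (h₂-telescope q r c (suc n) a) (h₃-telescope c n (a + p)) ⟩
    -ᶻ (c (a + N * q) -ᶻ c (a + N * r)) +ᶻ (h₂ p r c (suc n) (a + p) -ᶻ h₂ p q c (suc n) (a + p))
      ≡⟨ cong (_+ᶻ (h₂ p r c (suc n) (a + p) -ᶻ h₂ p q c (suc n) (a + p)))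
              (⁻¹-anti-homo‿- (c (a + N * q)) (c (a + N * r))) ⟩
    (c (a + N * r) -ᶻ c (a + N * q)) +ᶻ (h₂ p r c (suc n) (a + p) -ᶻ h₂ p q c (suc n) (a + p))
      ≡⟨ +-minus-interchange (c (a + N * r)) (h₂ p r c (suc n) (a + p)) (c (a + N * q)) (h₂ p q c (suc n) (a + p)) ⟨
    h₂ p r c (suc (suc n)) a -ᶻ h₂ p q c (suc (suc n)) a ∎
    where
    open ≡-Reasoning
    G = h₂ q r c (suc n)
    N = suc (suc n)

  vandermonde : (ℕ → ℤ) → ℕ → ℤ
  vandermonde f = Δ q p (Δ p r (Δ r q f))

  vandermonde-shiftLinear : ShiftLinear vandermonde
  vandermonde-shiftLinear =
    ∘-shiftLinear (Δ-shiftLinear q p) (∘-shiftLinear (Δ-shiftLinear p r) (Δ-shiftLinear r q))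

  cyclic : (ℕ → ℤ) → (ℕ → ℤ) → (ℕ → ℤ) → ℕ → ℤ
  cyclic gp gq gr a = Δ q r gp a +ᶻ Δ r p gq a +ᶻ Δ p q gr a

  -- (y - x)(x - z)(z - y) hₙ(x, y, z) = (y - z) xⁿ⁺² + (z - x) yⁿ⁺² + (x - y) zⁿ⁺²
  -- for the shifts x, y, z by p, q, r.
  vandermonde-h₃ : ∀ c n a → let N = suc (suc n) in
    vandermonde (h₃ c n) a ≡ cyclic (shift c (N * p)) (shift c (N * q)) (shift c (N * r)) a
  vandermonde-h₃ c n a = begin
    Δ q p (Δ p r (Δ r q (h₃ c n))) a
      ≡⟨ Δqp.pointwise-cong (Δpr.pointwise-cong (h₃-telescope c n)) a ⟩
    Δ q p (Δ p r (λ b → Hr b -ᶻ Hq b)) a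
      ≡⟨ Δqp.pointwise-cong (λ b → trans (Δpr.−-homo Hr Hq b)
                                         (cong (_-ᶻ Δ p r Hq b) (h₂-telescope p r c (suc n) b))) a ⟩
    Δ q p (λ b → (Pp b -ᶻ Pr b) -ᶻ Δ p r Hq b) a
      ≡⟨ Δqp.−-homo (λ b → Pp b -ᶻ Pr b) (Δ p r Hq) a ⟩
    Δ q p (λ b → Pp b -ᶻ Pr b) a -ᶻ Δ q p (Δ p r Hq) a
      ≡⟨ cong (λ t → A -ᶻ t) (Δpr.Δ-comm q p Hq a) ⟩
    Δ q p (λ b → Pp b -ᶻ Pr b) a -ᶻ Δ p r (Δ q p Hq) a
      ≡⟨ cong (λ t → A -ᶻ t) (Δpr.pointwise-cong swap a) ⟩
    Δ q p (λ b → Pp b -ᶻ Pr b) a -ᶻ Δ p r (λ b → -ᶻ (Pp b -ᶻ Pq b)) a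
      ≡⟨ cong (λ t → A -ᶻ t) (Δpr.-‿homo (λ b → Pp b -ᶻ Pq b) a) ⟩
    Δ q p (λ b → Pp b -ᶻ Pr b) a -ᶻ -ᶻ Δ p r (λ b → Pp b -ᶻ Pq b) a
      ≡⟨ cong (A +ᶻ_) (ℤP.neg-involutive _) ⟩
    Δ q p (λ b → Pp b -ᶻ Pr b) a +ᶻ Δ p r (λ b → Pp b -ᶻ Pq b) a
      ≡⟨ regroup (Pp (a + q)) (Pp (a + p)) (Pp (a + r)) (Pq (a + p)) (Pq (a + r)) (Pr (a + q)) (Pr (a + p)) ⟩
    cyclic Pp Pq Pr a ∎
    where
    open ≡-Reasoning
    module Δqp = ShiftLinear (Δ-shiftLinear q p)
    module Δpr = ShiftLinear (Δ-shiftLinear p r)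
    Hq = h₂ p q c (suc n)
    Hr = h₂ p r c (suc n)
    Pp = shift c (suc (suc n) * p)
    Pq = shift c (suc (suc n) * q)
    Pr = shift c (suc (suc n) * r)
    A = Δ q p (λ b → Pp b -ᶻ Pr b) a
    swap : ∀ b → Δ q p Hq b ≡ -ᶻ (Pp b -ᶻ Pq b)
    swap b = trans (sym (⁻¹-anti-homo‿- (Hq (b + p)) (Hq (b + q)))) (cong -ᶻ_ (h₂-telescope p q c (suc n) b))
    regroup : ∀ pq pp pr qp qr rq rp →
      ((pq -ᶻ rq) -ᶻ (pp -ᶻ rp)) +ᶻ ((pp -ᶻ qp) -ᶻ (pr -ᶻ qr)) ≡ (pq -ᶻ pr) +ᶻ (qr -ᶻ qp) +ᶻ (rp -ᶻ rq)
    regroup = ℤ-Solver.solve-∀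

  cyclic-+ : ∀ f₁ f₂ f₃ g₁ g₂ g₃ a →
    cyclic (λ b → f₁ b +ᶻ g₁ b) (λ b → f₂ b +ᶻ g₂ b) (λ b → f₃ b +ᶻ g₃ b) a ≡
    cyclic f₁ f₂ f₃ a +ᶻ cyclic g₁ g₂ g₃ a
  cyclic-+ f₁ f₂ f₃ g₁ g₂ g₃ a = begin
    Δ q r (λ b → f₁ b +ᶻ g₁ b) a +ᶻ Δ r p (λ b → f₂ b +ᶻ g₂ b) a +ᶻ Δ p q (λ b → f₃ b +ᶻ g₃ b) a
      ≡⟨ cong₂ _+ᶻ_ (cong₂ _+ᶻ_ (Δ-shiftLinear q r .+-homo f₁ g₁ a) (Δ-shiftLinear r p .+-homo f₂ g₂ a))
                    (Δ-shiftLinear p q .+-homo f₃ g₃ a) ⟩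
    (Δ q r f₁ a +ᶻ Δ q r g₁ a) +ᶻ (Δ r p f₂ a +ᶻ Δ r p g₂ a) +ᶻ (Δ p q f₃ a +ᶻ Δ p q g₃ a)
      ≡⟨ cong (_+ᶻ (Δ p q f₃ a +ᶻ Δ p q g₃ a)) (+ᶻ-interchange (Δ q r f₁ a) _ _ _) ⟩
    (Δ q r f₁ a +ᶻ Δ r p f₂ a) +ᶻ (Δ q r g₁ a +ᶻ Δ r p g₂ a) +ᶻ (Δ p q f₃ a +ᶻ Δ p q g₃ a)
      ≡⟨ +ᶻ-interchange (Δ q r f₁ a +ᶻ Δ r p f₂ a) _ _ _ ⟩
    cyclic f₁ f₂ f₃ a +ᶻ cyclic g₁ g₂ g₃ a ∎
    where open ≡-Reasoning

  vandermonde-tetrahedron : ∀ c n a →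
    vandermonde (tetrahedron c n) a ≡ cyclic (powerSum c p n) (powerSum c q n) (powerSum c r n) a
  vandermonde-tetrahedron c zero    a = refl
  vandermonde-tetrahedron c (suc n) a = begin
    vandermonde (tetrahedron c (suc n)) a
      ≡⟨ V.pointwise-cong (tetrahedron-suc c n) a ⟩
    vandermonde (λ b → tetrahedron c n b +ᶻ h₃ c n b) a
      ≡⟨ V.+-homo (tetrahedron c n) (h₃ c n) a ⟩
    vandermonde (tetrahedron c n) a +ᶻ vandermonde (h₃ c n) a
      ≡⟨ cong₂ _+ᶻ_ (vandermonde-tetrahedron c n a) (vandermonde-h₃ c n a) ⟩
    cyclic (powerSum c p n) (powerSum c q n) (powerSum c r n) a +ᶻ
      cyclic (shift c (suc (suc n) * p)) (shift c (suc (suc n) * q)) (shift c (suc (suc n) * r)) a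
      ≡⟨ cyclic-+ (powerSum c p n) (powerSum c q n) (powerSum c r n)
                 (shift c (suc (suc n) * p)) (shift c (suc (suc n) * q)) (shift c (suc (suc n) * r)) a ⟨
    cyclic (powerSum c p (suc n)) (powerSum c q (suc n)) (powerSum c r (suc n)) a ∎
    where
    open ≡-Reasoning
    module V = ShiftLinear vandermonde-shiftLinear

  cyclic-cong : ∀ {f₁ f₂ f₃ g₁ g₂ g₃} → (∀ b → f₁ b ≡ g₁ b) → (∀ b → f₂ b ≡ g₂ b) → (∀ b → f₃ b ≡ g₃ b) →
                ∀ a → cyclic f₁ f₂ f₃ a ≡ cyclic g₁ g₂ g₃ a
  cyclic-cong e₁ e₂ e₃ a =
    cong₂ _+ᶻ_ (cong₂ _+ᶻ_ (Δ-shiftLinear q r .pointwise-cong e₁ a) (Δ-shiftLinear r p .pointwise-cong e₂ a))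
               (Δ-shiftLinear p q .pointwise-cong e₃ a)

  cyclic≡0 : ∀ {gp gq gr} → (∀ a → Δ q r gp a ≡ 0ℤ) → Invariant 1 gq → Invariant 1 gr →
             ∀ a → cyclic gp gq gr a ≡ 0ℤ
  cyclic≡0 Δgp≡0 gq-constant gr-constant a =
    cong₂ _+ᶻ_ (cong₂ _+ᶻ_ (Δgp≡0 a) (invariant-1⇒Δ≡0 gq-constant r p a)) (invariant-1⇒Δ≡0 gr-constant p q a)

  cyclic-constant≡0 : ∀ c a → cyclic c c c a ≡ 0ℤ
  cyclic-constant≡0 c a = cancel (c (a + p)) (c (a + q)) (c (a + r))
    where
    cancel : ∀ x y z → (y -ᶻ z) +ᶻ (z -ᶻ x) +ᶻ (x -ᶻ y) ≡ 0ℤ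
    cancel = ℤ-Solver.solve-∀

  cyclic-shift≡0 : ∀ c a → cyclic (shift c p) (shift c q) (shift c r) a ≡ 0ℤ
  cyclic-shift≡0 c a = begin
    (c (a + q + p) -ᶻ c (a + r + p)) +ᶻ (c (a + r + q) -ᶻ c (a + p + q)) +ᶻ (c (a + p + r) -ᶻ c (a + q + r))
      ≡⟨ cong₂ (λ s t → (s -ᶻ t) +ᶻ (c (a + r + q) -ᶻ c (a + p + q)) +ᶻ (c (a + p + r) -ᶻ c (a + q + r)))
               (cong c (xy∙z≈xz∙y a q p)) (cong c (xy∙z≈xz∙y a r p)) ⟩
    (c (a + p + q) -ᶻ c (a + p + r)) +ᶻ (c (a + r + q) -ᶻ c (a + p + q)) +ᶻ (c (a + p + r) -ᶻ c (a + q + r))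
      ≡⟨ cong (λ s → (c (a + p + q) -ᶻ c (a + p + r)) +ᶻ (c s -ᶻ c (a + p + q)) +ᶻ (c (a + p + r) -ᶻ c (a + q + r)))
              (xy∙z≈xz∙y a r q) ⟩
    (c (a + p + q) -ᶻ c (a + p + r)) +ᶻ (c (a + q + r) -ᶻ c (a + p + q)) +ᶻ (c (a + p + r) -ᶻ c (a + q + r))
      ≡⟨ cancel (c (a + p + q)) (c (a + p + r)) (c (a + q + r)) ⟩
    0ℤ ∎
    where
    open ≡-Reasoning
    cancel : ∀ x y z → (x -ᶻ y) +ᶻ (z -ᶻ x) +ᶻ (y -ᶻ z) ≡ 0ℤ
    cancel = ℤ-Solver.solve-∀

  -- Since m ∣ 2 + s, the top two layers involve the shifts by (2 + s) x ≡ 0 and (3 + s) x ≡ x.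
  vandermonde-top-layers≡0 : ∀ m {c} → Invariant m c → ∀ s t → 2 + s ≡ t * m →
                             ∀ a → vandermonde (λ b → h₃ c s b +ᶻ h₃ c (suc s) b) a ≡ 0ℤ
  vandermonde-top-layers≡0 m {c} periodic s t 2+s≡tm a = begin
    vandermonde (λ b → h₃ c s b +ᶻ h₃ c (suc s) b) a
      ≡⟨ ShiftLinear.+-homo vandermonde-shiftLinear (h₃ c s) (h₃ c (suc s)) a ⟩
    vandermonde (h₃ c s) a +ᶻ vandermonde (h₃ c (suc s)) a
      ≡⟨ cong₂ _+ᶻ_ (vandermonde-h₃ c s a) (vandermonde-h₃ c (suc s) a) ⟩
    cyclic (shift c ((2 + s) * p)) (shift c ((2 + s) * q)) (shift c ((2 + s) * r)) a +ᶻ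
      cyclic (shift c ((3 + s) * p)) (shift c ((3 + s) * q)) (shift c ((3 + s) * r)) a
      ≡⟨ cong₂ _+ᶻ_ (trans (cyclic-cong (wrap p) (wrap q) (wrap r) a) (cyclic-constant≡0 c a))
                    (trans (cyclic-cong (wrap-suc p) (wrap-suc q) (wrap-suc r) a) (cyclic-shift≡0 c a)) ⟩
    0ℤ ∎
    where
    open ≡-Reasoning
    wrap : ∀ x b → c (b + (2 + s) * x) ≡ c b
    wrap x b = begin
      c (b + (2 + s) * x)   ≡⟨ cong (λ n → c (b + n * x)) 2+s≡tm ⟩
      c (b + t * m * x)     ≡⟨ cong c (solve (b ∷ t ∷ m ∷ x ∷ [])) ⟩
      c (b + (t * x) * m)   ≡⟨ invariant-* periodic (t * x) b ⟩
      c b                   ∎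
    wrap-suc : ∀ x b → c (b + (3 + s) * x) ≡ c (b + x)
    wrap-suc x b = trans (cong c (sym (ℕP.+-assoc b x _))) (wrap x (b + x))

  module _ (2∣p : 2 ∣ p) (2∣1+q : 2 ∣ suc q) (2∣1+r : 2 ∣ suc r) where

    module _ {e : ℕ → ℤ} (alt : Alternating e) where

      line-alternating-suc : ∀ n a → line e (suc n) a ≡ e a -ᶻ line e n a
      line-alternating-suc n a =
        cong (e a +ᶻ_) (alternating-odd (ShiftLinear.alternating (line-shiftLinear n) alt) 2∣1+r a)

      line-alternating-even : ∀ k a → line e (k * 2) a ≡ 0ℤ
      line-alternating-even zero    a = refl
      line-alternating-even (suc k) a = begin
        line e (suc (suc (k * 2))) a          ≡⟨ line-alternating-suc (suc (k * 2)) a ⟩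
        e a -ᶻ line e (suc (k * 2)) a         ≡⟨ cong (λ t → e a -ᶻ t) (line-alternating-suc (k * 2) a) ⟩
        e a -ᶻ (e a -ᶻ line e (k * 2) a)      ≡⟨ i-[i-j]≡j (e a) (line e (k * 2) a) ⟩
        line e (k * 2) a                      ≡⟨ line-alternating-even k a ⟩
        0ℤ                                    ∎
        where open ≡-Reasoning

      triangle-alternating-suc : ∀ n a → triangle e (suc n) a ≡ line e (suc n) a -ᶻ triangle e n a
      triangle-alternating-suc n a =
        cong (line e (suc n) a +ᶻ_) (alternating-odd (ShiftLinear.alternating (triangle-shiftLinear n) alt) 2∣1+q a)

      tetrahedron-alternating-suc : ∀ n a → tetrahedron e (suc n) a ≡ triangle e (suc n) a +ᶻ tetrahedron e n a
      tetrahedron-alternating-suc n a =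
        cong (triangle e (suc n) a +ᶻ_)
             (invariant-∣ (alternating⇒invariant-2 (ShiftLinear.alternating (tetrahedron-shiftLinear n) alt)) 2∣p a)

      tetrahedron-alternating-even : ∀ k a → tetrahedron e (k * 2) a ≡ 0ℤ
      tetrahedron-alternating-even zero    a = refl
      tetrahedron-alternating-even (suc k) a = begin
        tetrahedron e (suc (suc (k * 2))) a
          ≡⟨ tetrahedron-alternating-suc (suc (k * 2)) a ⟩
        triangle e (suc (suc (k * 2))) a +ᶻ tetrahedron e (suc (k * 2)) a
          ≡⟨ cong₂ _+ᶻ_ (triangle-alternating-suc (suc (k * 2)) a) (tetrahedron-alternating-suc (k * 2) a) ⟩
        (line e (suc (suc (k * 2))) a -ᶻ T) +ᶻ (T +ᶻ tetrahedron e (k * 2) a)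
          ≡⟨ cancel (line e (suc (suc (k * 2))) a) T (tetrahedron e (k * 2) a) ⟩
        line e (suc k * 2) a +ᶻ tetrahedron e (k * 2) a
          ≡⟨ cong₂ _+ᶻ_ (line-alternating-even (suc k) a) (tetrahedron-alternating-even k a) ⟩
        0ℤ ∎
        where
        open ≡-Reasoning
        T = triangle e (suc (k * 2)) a
        cancel : ∀ x y z → (x -ᶻ y) +ᶻ (y +ᶻ z) ≡ x +ᶻ z
        cancel = ℤ-Solver.solve-∀

    -- T commutes with  alternation j,  which makes c alternating (so T of it vanishes) and
    -- turns the 2-invariant T c into j times its step T c b - T c (b + 1).
    tetrahedron-invariant-2⇒invariant-1 : ∀ j .{{_ : NonZero j}} {c} → Invariant (j * 2) c →
      ∀ {n} → 2 ∣ n → Invariant 2 (tetrahedron c n) → Invariant 1 (tetrahedron c n)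
    tetrahedron-invariant-2⇒invariant-1 j {c} periodic {n} (divides k refl) inv₂ b
      with ℤP.i*j≡0⇒i≡0∨j≡0 (ℤ.+ j) j·step≡0
      where
      T = tetrahedron c n
      j·step≡0 : ℤ.+ j *ᶻ (T b -ᶻ T (b + 1)) ≡ 0ℤ
      j·step≡0 = begin
        ℤ.+ j *ᶻ (T b -ᶻ T (b + 1))  ≡⟨ alternation-invariant-2 j inv₂ b ⟨
        alternation j T b             ≡⟨ ShiftLinear.alternation-comm (tetrahedron-shiftLinear n) j c b ⟨
        tetrahedron (alternation j c) n b
                                      ≡⟨ tetrahedron-alternating-even (alternation-alternating j periodic) k b ⟩
        0ℤ                            ∎
        where open ≡-Reasoning
    ... | inj₁ j≡0    = ⊥-elim (ℕ.≢-nonZero⁻¹ j (ℤP.+-injective j≡0))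
    ... | inj₂ step≡0 = sym (ℤP.i-j≡0⇒i≡j _ _ step≡0)


-- Balance of the tetrahedral sums

unit⇒odd : ∀ {m} .{{_ : NonZero m}} → 2 ∣ m → ∀ {x} → Invertible m x → 2 ∣ suc x
unit⇒odd {m} 2∣m {x} (y , xy≡1) with x % 2 | m%n<n x 2 | m≡m%n+[m/n]*n x 2
... | 1           | _                     | x≡ = divides (suc (x / 2)) (cong suc x≡)
... | suc (suc _) | ℕ.s≤s (ℕ.s≤s ())    | _
... | 0           | _                     | x≡ with ∣1⇒≡1 2∣1
  where
  2∣1 : 2 ∣ 1
  2∣1 = subst (2 ∣_) (trans xy≡1 (m<n⇒m%n≡m (∣⇒≤ 2∣m))) (%-presˡ-∣ (∣m⇒∣m*n y (divides (x / 2) x≡)) 2∣m)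
... | ()

gcd≡2⇒even : ∀ {x m} → gcd x m ≡ 2 → 2 ∣ x
gcd≡2⇒even {x} {m} gcd≡2 = subst (_∣ x) gcd≡2 (gcd[m,n]∣m x m)

module Balance (m : ℕ) .{{_ : NonZero m}} (d₁ d₂ d₃ : Fin m) (2∣m : 2 ∣ m)
  (gcd[d₁,m]≡2 : gcd (toℕ d₁) m ≡ 2) (gcd[d₃-d₂,m]≡2 : gcd (sub m d₃ d₂) m ≡ 2)
  (d₂-unit : Invertible m (toℕ d₂)) (d₃-unit : Invertible m (toℕ d₃))
  (d₂-d₁-unit : Invertible m (sub m d₂ d₁)) (d₁-d₃-unit : Invertible m (sub m d₁ d₃)) where

  private
    p = toℕ d₁
    q = toℕ d₂
    r = toℕ d₃

  open Simplex p q r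

  vandermonde≡0⇒invariant-2 : ∀ {F} → Invariant m F → (∀ a → vandermonde F a ≡ 0ℤ) → Invariant 2 F
  vandermonde≡0⇒invariant-2 {F} periodic V≡0 =
    subst (λ h → Invariant h F) gcd[d₃-d₂,m]≡2 (invariant-gcd (Δ≡0⇒invariant d₃ d₂ ΔrqF≡0))
    where
    open Periodic m periodic
    ΔprΔrqF≡0 : ∀ a → Δ p r (Δ r q F) a ≡ 0ℤ
    ΔprΔrqF≡0 = Δ-Δ≡0⇒Δ≡0 m (Δ-invariant r q periodic) d₂ d₁ p r d₂-d₁-unit V≡0
    ΔrqF≡0 : ∀ a → Δ r q F a ≡ 0ℤ
    ΔrqF≡0 = Δ-Δ≡0⇒Δ≡0 m periodic d₁ d₃ r q d₁-d₃-unit ΔprΔrqF≡0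

  private
    2∣p : 2 ∣ p
    2∣p = gcd≡2⇒even gcd[d₁,m]≡2
    2∣1+q : 2 ∣ suc q
    2∣1+q = unit⇒odd 2∣m d₂-unit
    2∣1+r : 2 ∣ suc r
    2∣1+r = unit⇒odd 2∣m d₃-unit
    j : ℕ
    j = m / 2
    instance
      j-nonZero : NonZero j
      j-nonZero = ℕ.>-nonZero (m≥n⇒m/n>0 (∣⇒≤ 2∣m))
    m≡j*2 : m ≡ j * 2
    m≡j*2 = sym (m/n*n≡m 2∣m)

  tetrahedron-periodic : ∀ {c} → Invariant m c → ∀ n → Invariant m (tetrahedron c n)
  tetrahedron-periodic periodic n = ShiftLinear.invariant (tetrahedron-shiftLinear n) periodic

  invariant-2⇒invariant-1 : ∀ {c} → Invariant m c → ∀ {n} → 2 ∣ n →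
                            Invariant 2 (tetrahedron c n) → Invariant 1 (tetrahedron c n)
  invariant-2⇒invariant-1 {c} periodic =
    tetrahedron-invariant-2⇒invariant-1 2∣p 2∣1+q 2∣1+r j (subst (λ h → Invariant h c) m≡j*2 periodic)

  tetrahedron-multiple : ∀ {c} → Invariant m c → ∀ t → Invariant 1 (tetrahedron c (t * m))
  tetrahedron-multiple {c} periodic t =
    invariant-2⇒invariant-1 periodic (∣n⇒∣m*n t 2∣m)
      (vandermonde≡0⇒invariant-2 (tetrahedron-periodic periodic (t * m)) λ a →
        trans (vandermonde-tetrahedron c (t * m) a)
              (cyclic≡0 {S p} Δqr≡0 (S-constant q d₂-unit) (S-constant r d₃-unit) a))
    where
    S : ℕ → ℕ → ℤ
    S x = powerSum c x (t * m)
    S-constant : ∀ x → Invertible m x → Invariant 1 (S x)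
    S-constant x unit =
      Periodic.invariant-unit m (powerSum-invariant periodic x (t * m)) (powerSum-multiple-invariant m periodic x t) unit
    Δqr≡0 : ∀ a → Δ q r (S p) a ≡ 0ℤ
    Δqr≡0 = invariant-2⇒Δ-odd≡0
      (subst (λ h → Invariant h (S p)) gcd[d₁,m]≡2
        (Periodic.invariant-gcd m (powerSum-invariant periodic p (t * m)) (powerSum-multiple-invariant m periodic p t)))
      2∣1+q 2∣1+r

  tetrahedron-before-multiple : ∀ {c} → Invariant m c → ∀ s t → 2 + s ≡ t * m → Invariant 1 (tetrahedron c s)
  tetrahedron-before-multiple {c} periodic s t 2+s≡tm =
    invariant-2⇒invariant-1 periodic
      (∣m+n∣m⇒∣n (subst (2 ∣_) (sym 2+s≡tm) (∣n⇒∣m*n t 2∣m)) (divides 1 refl)) T-invariant-2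
    where
    T = tetrahedron c
    U : ℕ → ℤ
    U b = T (2 + s) b -ᶻ T s b
    U-invariant-2 : Invariant 2 U
    U-invariant-2 = vandermonde≡0⇒invariant-2
      (λ b → cong₂ _-ᶻ_ (tetrahedron-periodic periodic (2 + s) b) (tetrahedron-periodic periodic s b))
      (λ a → trans (ShiftLinear.pointwise-cong vandermonde-shiftLinear U≡top-layers a)
                   (vandermonde-top-layers≡0 m periodic s t 2+s≡tm a))
      where
      U≡top-layers : ∀ b → U b ≡ h₃ c s b +ᶻ h₃ c (suc s) b
      U≡top-layers b =
        trans (cong (_-ᶻ T s b) (tetrahedron-suc-suc c s b)) (xyx⁻¹≈y (T s b) (h₃ c s b +ᶻ h₃ c (suc s) b))
    T-invariant-2 : Invariant 2 (T s)
    T-invariant-2 b = begin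
      T s (b + 2)                      ≡⟨ i-[i-j]≡j (T (2 + s) (b + 2)) (T s (b + 2)) ⟨
      T (2 + s) (b + 2) -ᶻ U (b + 2)   ≡⟨ cong₂ _-ᶻ_ (invariant-1⇒invariant T₂-constant 2 b) (U-invariant-2 b) ⟩
      T (2 + s) b -ᶻ U b               ≡⟨ i-[i-j]≡j (T (2 + s) b) (T s b) ⟩
      T s b                            ∎
      where
      open ≡-Reasoning
      T₂-constant : Invariant 1 (T (2 + s))
      T₂-constant = subst (λ n → Invariant 1 (T n)) (sym 2+s≡tm) (tetrahedron-multiple periodic t)

  tetrahedron-invariant : ∀ {c} → Invariant m c →
                          ∀ s → s % m ≡ 0 ⊎ (s + 2) % m ≡ 0 → Invariant 1 (tetrahedron c s)
  tetrahedron-invariant {c} periodic s (inj₁ s%m≡0) with m%n≡0⇒n∣m s m s%m≡0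
  ... | divides t refl = tetrahedron-multiple periodic t
  tetrahedron-invariant {c} periodic s (inj₂ [s+2]%m≡0) with m%n≡0⇒n∣m (s + 2) m [s+2]%m≡0
  ... | divides t s+2≡tm = tetrahedron-before-multiple periodic s t (trans (ℕP.+-comm 2 s) s+2≡tm)

-- Multiplicities

indicator : ℕ → ℕ → ℤ
indicator x y = if does (y ≟ x) then ℤ.+ 1 else 0ℤ

indicator-≡ : ∀ {x y} → y ≡ x → indicator x y ≡ ℤ.+ 1
indicator-≡ {x} {y} y≡x = cong (if_then ℤ.+ 1 else 0ℤ) (dec-true (y ≟ x) y≡x)

indicator-≢ : ∀ {x y} → ¬ y ≡ x → indicator x y ≡ 0ℤ
indicator-≢ {x} {y} y≢x = cong (if_then ℤ.+ 1 else 0ℤ) (dec-false (y ≟ x) y≢x)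

residue-indicator : ∀ m .{{_ : NonZero m}} → ℕ → ℕ → ℤ
residue-indicator m x b = indicator x (b % m)

module _ {A : Set} {g : A → ℕ} {x : ℕ} where

  private
    count : List A → ℤ
    count l = ℤ.+ mult (map g l) x

  count-∷ : ∀ t l → count (t ∷ l) ≡ indicator x (g t) +ᶻ count l
  count-∷ t l with does (g t ≟ x)
  ... | true  = refl
  ... | false = refl

  count-++ : ∀ l l′ → count (l ++ l′) ≡ count l +ᶻ count l′
  count-++ []      l′ = refl
  count-++ (t ∷ l) l′ = begin
    count (t ∷ l ++ l′)                          ≡⟨ count-∷ t (l ++ l′) ⟩
    indicator x (g t) +ᶻ count (l ++ l′)         ≡⟨ cong (indicator x (g t) +ᶻ_) (count-++ l l′) ⟩
    indicator x (g t) +ᶻ (count l +ᶻ count l′)   ≡⟨ ℤP.+-assoc (indicator x (g t)) (count l) (count l′) ⟨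
    indicator x (g t) +ᶻ count l +ᶻ count l′     ≡⟨ cong (_+ᶻ count l′) (count-∷ t l) ⟨
    count (t ∷ l) +ᶻ count l′                    ∎
    where open ≡-Reasoning

  count-concatMap : ∀ {B : Set} (G : B → List A) h n →
                    count (concatMap G (applyUpTo h n)) ≡ Σ< n (λ i → count (G (h i)))
  count-concatMap G h zero    = refl
  count-concatMap G h (suc n) =
    trans (count-++ (G (h 0)) _) (cong (count (G (h 0)) +ᶻ_) (count-concatMap G (h ∘ suc) n))

  count-map : ∀ {B : Set} (K : B → A) h n →
              count (map K (applyUpTo h n)) ≡ Σ< n (λ i → indicator x (g (K (h i))))
  count-map K h zero    = refl
  count-map K h (suc n) =
    trans (count-∷ (K (h 0)) _) (cong (indicator x (g (K (h 0))) +ᶻ_) (count-map K (h ∘ suc) n))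

multiplicity≡tetrahedron : ∀ m .{{_ : NonZero m}} (a d₁ d₂ d₃ : Fin m) s x →
  ℤ.+ mult (AS m a d₁ d₂ d₃ s) x ≡
  Simplex.tetrahedron (toℕ d₁) (toℕ d₂) (toℕ d₃) (residue-indicator m x) s (toℕ a)
multiplicity≡tetrahedron m a d₁ d₂ d₃ s x =
  trans (count-concatMap _ (λ i → i) s)
    (trans (Σ<-cong s λ i → trans (count-concatMap _ (λ j → j) (s ∸ i))
                                  (Σ<-cong (s ∸ i) λ j → count-map _ (λ k → k) (s ∸ (i + j))))
           (Simplex.tetrahedron-Σ (toℕ d₁) (toℕ d₂) (toℕ d₃) (residue-indicator m x) s (toℕ a)))

module _ (m : ℕ) .{{_ : NonZero m}} where

  residue-indicator-periodic : ∀ x → Invariant m (residue-indicator m x)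
  residue-indicator-periodic x b = cong (indicator x) ([m+n]%n≡m%n b m)

  [a+b]%m≡[a%m+b]%m : ∀ a b → (a + b) % m ≡ (a % m + b) % m
  [a+b]%m≡[a%m+b]%m a b = begin
    (a + b) % m                  ≡⟨ %-distribˡ-+ a b m ⟩
    (a % m + b % m) % m          ≡⟨ cong (λ t → (t + b % m) % m) (m%n%n≡m%n a m) ⟨
    (a % m % m + b % m) % m      ≡⟨ %-distribˡ-+ (a % m) b m ⟨
    (a % m + b) % m              ∎
    where open ≡-Reasoning

  [x+[y+[m∸x]]]%m≡y%m : ∀ {x} y → x ≤ m → (x + (y + (m ∸ x))) % m ≡ y % m
  [x+[y+[m∸x]]]%m≡y%m {x} y x≤m = begin
    (x + (y + (m ∸ x))) % m      ≡⟨ cong (_% m) (x∙yz≈y∙xz x y (m ∸ x)) ⟩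
    (y + (x + (m ∸ x))) % m      ≡⟨ cong (λ t → (y + t) % m) (ℕP.m+[n∸m]≡n x≤m) ⟩
    (y + m) % m                  ≡⟨ [m+n]%n≡m%n y m ⟩
    y % m                        ∎
    where open ≡-Reasoning

  [b+[y+[m∸x]]+[x+[m∸y]]]%m≡b%m : ∀ {x y} b → x ≤ m → y ≤ m →
                                  (b + (y + (m ∸ x)) + (x + (m ∸ y))) % m ≡ b % m
  [b+[y+[m∸x]]+[x+[m∸y]]]%m≡b%m {x} {y} b x≤m y≤m = begin
    (b + (y + (m ∸ x)) + (x + (m ∸ y))) % m    ≡⟨ cong (_% m) (rearrange b x y (m ∸ x) (m ∸ y)) ⟩
    (b + (x + (m ∸ x)) + (y + (m ∸ y))) % m    ≡⟨ cong₂ (λ s t → (b + s + t) % m) (ℕP.m+[n∸m]≡n x≤m) (ℕP.m+[n∸m]≡n y≤m) ⟩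
    (b + m + m) % m                            ≡⟨ [m+n]%n≡m%n (b + m) m ⟩
    (b + m) % m                                ≡⟨ [m+n]%n≡m%n b m ⟩
    b % m                                      ∎
    where
    open ≡-Reasoning
    rearrange : ∀ b x y u v → b + (y + u) + (x + v) ≡ b + (x + u) + (y + v)
    rearrange = ℕ-solve-∀

  indicator-translate : ∀ {x y} → x < m → y < m → ∀ b →
    residue-indicator m y (b + (y + (m ∸ x))) ≡ residue-indicator m x b
  indicator-translate {x} {y} x<m y<m b with b % m ≟ x
  ... | yes b%m≡x = trans (indicator-≡ hits) (sym (indicator-≡ b%m≡x))
    where
    hits : (b + (y + (m ∸ x))) % m ≡ y
    hits = begin
      (b + (y + (m ∸ x))) % m        ≡⟨ [a+b]%m≡[a%m+b]%m b _ ⟩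
      (b % m + (y + (m ∸ x))) % m    ≡⟨ cong (λ t → (t + (y + (m ∸ x))) % m) b%m≡x ⟩
      (x + (y + (m ∸ x))) % m        ≡⟨ [x+[y+[m∸x]]]%m≡y%m y (ℕP.<⇒≤ x<m) ⟩
      y % m                          ≡⟨ m<n⇒m%n≡m y<m ⟩
      y                              ∎
      where open ≡-Reasoning
  ... | no b%m≢x = trans (indicator-≢ (b%m≢x ∘ back)) (sym (indicator-≢ b%m≢x))
    where
    back : (b + (y + (m ∸ x))) % m ≡ y → b % m ≡ x
    back hits = begin
      b % m                                              ≡⟨ [b+[y+[m∸x]]+[x+[m∸y]]]%m≡b%m b (ℕP.<⇒≤ x<m) (ℕP.<⇒≤ y<m) ⟨
      (b + (y + (m ∸ x)) + (x + (m ∸ y))) % m            ≡⟨ [a+b]%m≡[a%m+b]%m (b + (y + (m ∸ x))) _ ⟩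
      ((b + (y + (m ∸ x))) % m + (x + (m ∸ y))) % m      ≡⟨ cong (λ t → (t + (x + (m ∸ y))) % m) hits ⟩
      (y + (x + (m ∸ y))) % m                            ≡⟨ [x+[y+[m∸x]]]%m≡y%m x (ℕP.<⇒≤ y<m) ⟩
      x % m                                              ≡⟨ m<n⇒m%n≡m x<m ⟩
      x                                                  ∎
      where open ≡-Reasoning

theorem3p15 : (m : ℕ) → .{{_ : NonZero m}} → 2 ∣ m → ¬ (3 ∣ m) →
    (a d₁ d₂ d₃ : Fin m) →
    gcd (toℕ d₁) m ≡ 2 → gcd (sub m d₃ d₂) m ≡ 2 →
    Invertible m (toℕ d₂) → Invertible m (toℕ d₃) →
    Invertible m (sub m d₂ d₁) → Invertible m (sub m d₁ d₃) →
    (s : ℕ) → 0 < s → (s % m ≡ 0 ⊎ (s + 2) % m ≡ 0) →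
    Balanced m (AS m a d₁ d₂ d₃ s)
-- ¬ 3 ∣ m follows from the other hypotheses (it would force d₁ ≡ 0 mod 3), and s = 0 is harmless.
theorem3p15 m 2∣m _ a d₁ d₂ d₃ gcd₁ gcd₃₂ unit₂ unit₃ unit₂₁ unit₁₃ s _ s≡0∨s≡-2 x y =
  ℤP.+-injective (begin
    ℤ.+ mult (AS m a d₁ d₂ d₃ s) (toℕ x)        ≡⟨ multiplicity≡tetrahedron m a d₁ d₂ d₃ s (toℕ x) ⟩
    tetrahedron (residue-indicator m (toℕ x)) s A
      ≡⟨ T.pointwise-cong (indicator-translate m (toℕ<n x) (toℕ<n y)) A ⟨
    tetrahedron (shift (residue-indicator m (toℕ y)) k) s A
      ≡⟨ T.shift-comm (residue-indicator m (toℕ y)) k A ⟩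
    tetrahedron (residue-indicator m (toℕ y)) s (A + k)
      ≡⟨ invariant-1⇒invariant (tetrahedron-invariant (residue-indicator-periodic m (toℕ y)) s s≡0∨s≡-2) k A ⟩
    tetrahedron (residue-indicator m (toℕ y)) s A   ≡⟨ multiplicity≡tetrahedron m a d₁ d₂ d₃ s (toℕ y) ⟨
    ℤ.+ mult (AS m a d₁ d₂ d₃ s) (toℕ y)        ∎)
  where
  open ≡-Reasoning
  open Simplex (toℕ d₁) (toℕ d₂) (toℕ d₃)
  open Balance m d₁ d₂ d₃ 2∣m gcd₁ gcd₃₂ unit₂ unit₃ unit₂₁ unit₁₃
  module T = ShiftLinear (tetrahedron-shiftLinear s)
  A = toℕ a
  k = toℕ y + (m ∸ toℕ x)
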